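{- If $|A|>1$ and $t,u$ are $\mathrm{BCCS}(A)$ terms with $t\sqsubseteq_{\rm WIF}u$, then $\mathcal{T}_A(t)=\mathcal{T}_A(u)$ and $\mathcal{T}_V(t)=\mathcal{T}_V(u)$.
   Context: $\mathrm{BCCS}(A)$: $A$ nonempty set of visible actions, $\tau\notin A$, countably infinite variable set $V$; terms $t::=\mathbf{0}\mid\alpha t\mid t+t\mid x$, $\alpha\in A\cup\{\tau\}$. Transitions: $\alpha t\xrightarrow{\alpha}t$; if $t\xrightarrow{\alpha}t'$ then $t+u\xrightarrow{\alpha}t'$, $u+t\xrightarrow{\alpha}t'$; variables have no transitions. $\Rightarrow$: zero or more $\tau$-steps. Traces of a closed term $p_0$: $a_1\cdots a_k\in A^*$ with $p_0\Rightarrow\xrightarrow{a_1}\Rightarrow\cdots\Rightarrow\xrightarrow{a_k}\Rightarrow p_k$; set $\mathcal{T}(p_0)$. $(a_1\cdots a_k,B)$, $B\subseteq A^*$, is a weak impossible future of $p_0$ if such a path exists with $\mathcal{T}(p_k)\cap B=\emptyset$. $p\sqsubseteq_{\rm WIF}q$ iff (1) every weak impossible future of $p$ is one of $q$, (2) $\mathcal{T}(p)=\mathcal{T}(q)$, (3) $p\xrightarrow{\tau}$ implies $q\xrightarrow{\tau}$; for open terms, $t\sqsubseteq_{\rm WIF}u$ iff $\sigma(t)\sqsubseteq_{\rm WIF}\sigma(u)$ for all closed substitutions $\sigma$. Traces of open terms: treat each occurrence of a variable $x$ as a subterm $x\mathbf{0}$ with $x$ regarded as a visible action; thus traces of a term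 $t$ lie in $A^*\cup A^*V$. $\mathcal{T}_A(t)$ is the set of traces of $t$ in $A^*$ and $\mathcal{T}_V(t)$ the set of traces of $t$ ending in a variable. -}

module Defs where

open import Data.Nat using (ℕ)
open import Data.List using (List; []; _∷_; _++_)
open import Data.Product using (Σ; ∃; _×_; _,_)
open import Data.Empty using (⊥)
open import Relation.Binary.PropositionalEquality using (_≡_)

V : Set
V = ℕ

data Act (A : Set) : Set where
  τ   : Act A
  vis : A → Act A

-- BCCS(A) terms over a variable type X (closed terms: X = ⊥).
data Term (A : Set) (X : Set) : Set where
  𝟎    : Term A X
  _·_  : Act A → Term A X → Term A X
  _⊕_  : Term A X → Term A X → Term A X
  var  : X → Term A X

infixr 7 _·_
infixl 6 _⊕_

data _—⟨_⟩→_ {A X : Set} : Term A X → Act A → Term A X → Set where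
  pre  : ∀ {α t} → (α · t) —⟨ α ⟩→ t
  sumˡ : ∀ {t u α t'} → t —⟨ α ⟩→ t' → (t ⊕ u) —⟨ α ⟩→ t'
  sumʳ : ∀ {t u α t'} → t —⟨ α ⟩→ t' → (u ⊕ t) —⟨ α ⟩→ t'

data _⇒_ {A X : Set} : Term A X → Term A X → Set where
  done : ∀ {t} → t ⇒ t
  step : ∀ {t t' t''} → t —⟨ τ ⟩→ t' → t' ⇒ t'' → t ⇒ t''

data _=[_]⇒_ {A X : Set} : Term A X → List A → Term A X → Set where
  wnil  : ∀ {t t'} → t ⇒ t' → t =[ [] ]⇒ t'
  wcons : ∀ {t t₁ t₂ t' a w} → t ⇒ t₁ → t₁ —⟨ vis a ⟩→ t₂ → t₂ =[ w ]⇒ t'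
        → t =[ a ∷ w ]⇒ t'

Traces : {A X : Set} → Term A X → List A → Set
Traces t w = ∃ λ t' → t =[ w ]⇒ t'

-- Variable x occurs as an initial summand (i.e. t can perform the
-- "visible action" x when x is read as the term x𝟎).
data CanVar {A X : Set} : Term A X → X → Set where
  here  : ∀ {x} → CanVar (var x) x
  varˡ  : ∀ {t u x} → CanVar t x → CanVar (t ⊕ u) x
  varʳ  : ∀ {t u x} → CanVar t x → CanVar (u ⊕ t) x

-- 𝒯_V: traces w·x in A*V (represented by the pair (w , x)).
TracesV : {A X : Set} → Term A X → List A → X → Set
TracesV t w x = ∃ λ t' → (t =[ w ]⇒ t') × CanVar t' x

WIF : {A : Set} → Term A ⊥ → List A → (List A → Set) → Set
WIF p w B = ∃ λ p' → (p =[ w ]⇒ p') × (∀ v → Traces p' v → B v → ⊥)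

_⊑WIFᶜ_ : {A : Set} → Term A ⊥ → Term A ⊥ → Set₁
p ⊑WIFᶜ q =
  (∀ w (B : _ → Set) → WIF p w B → WIF q w B)
  × (∀ w → (Traces p w → Traces q w) × (Traces q w → Traces p w))
  × ((∃ λ p' → p —⟨ τ ⟩→ p') → ∃ λ q' → q —⟨ τ ⟩→ q')

subst : {A : Set} → (V → Term A ⊥) → Term A V → Term A ⊥
subst σ 𝟎 = 𝟎
subst σ (α · t) = α · subst σ t
subst σ (t ⊕ u) = subst σ t ⊕ subst σ u
subst σ (var x) = σ x

_⊑WIF_ : {A : Set} → Term A V → Term A V → Set₁
t ⊑WIF u = ∀ (σ : V → Term _ ⊥) → subst σ t ⊑WIFᶜ subst σ u

-- The closed substitution σ₀ mapping every variable to 𝟎 makes the traces of σ₀(t)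
-- exactly those of t in A*, so trace equivalence of σ₀(t) and σ₀(u) gives 𝒯_A(t) = 𝒯_A(u).
-- For w·x ∈ 𝒯_V(t), let σ map x to b aᴺ (N the depth of u) and every other variable to 𝟎.
-- Then w b aᴺ is a trace of σ(t), hence of σ(u). It is too long to be a trace of u itself,
-- so it passes through a variable of u, which must be x; since b occurs only once in
-- w b aᴺ, that variable is reached after exactly w, i.e. w·x ∈ 𝒯_V(u).
module Submission where

open import Defs
open import Data.List using (List; []; _∷_; _++_; length; take; replicate)
open import Data.List.Properties using (∷-injective; ++-identityʳ; length-++; length-replicate)
open import Data.List.Relation.Unary.All using (All; []; _∷_)
open import Data.List.Relation.Unary.All.Properties using (take⁺; replicate⁺)
open import Data.Product using (∃; ∃₂; _×_; _,_; proj₁; proj₂)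
open import Data.Sum using (_⊎_; inj₁; inj₂)
open import Data.Empty using (⊥; ⊥-elim)
open import Data.Nat using (ℕ; zero; suc; _≤_; _<_; z≤n; s≤s; _⊔_; _≟_)
open import Data.Nat.Properties
  using (≤-refl; ≤-trans; n≤1+n; m≤m⊔n; m≤n⊔m; m≤n+m; <⇒≱)
open import Relation.Nullary using (¬_; yes; no)
open import Relation.Binary.PropositionalEquality
  using (_≡_; _≢_; refl; sym; trans; cong; cong₂) renaming (subst to ≡-subst)

module _ {A : Set} where

  ¬All≢-++-∷ : {b : A} (z : List A) {y : List A} → All (_≢ b) (z ++ b ∷ y) → ⊥
  ¬All≢-++-∷ [] (b≢b ∷ _) = b≢b refl
  ¬All≢-++-∷ (_ ∷ z) (_ ∷ n) = ¬All≢-++-∷ z n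

  ++-∷-cancelʳ : {b : A} (w w₁ : List A) {y y₁ : List A} → w ++ b ∷ y ≡ w₁ ++ b ∷ y₁
               → All (_≢ b) y → All (_≢ b) y₁ → w ≡ w₁
  ++-∷-cancelʳ [] [] e ny ny₁ = refl
  ++-∷-cancelʳ [] (_ ∷ w₁) refl ny ny₁ = ⊥-elim (¬All≢-++-∷ w₁ ny)
  ++-∷-cancelʳ (_ ∷ w) [] refl ny ny₁ = ⊥-elim (¬All≢-++-∷ w ny₁)
  ++-∷-cancelʳ (_ ∷ w) (_ ∷ w₁) e ny ny₁ =
    cong₂ _∷_ (proj₁ (∷-injective e)) (++-∷-cancelʳ w w₁ (proj₂ (∷-injective e)) ny ny₁)

  n<length-++-∷-replicate : (w : List A) (b a : A) (N : ℕ) → N < length (w ++ b ∷ replicate N a)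
  n<length-++-∷-replicate w b a N rewrite length-++ w {b ∷ replicate N a} | length-replicate N {a} =
    m≤n+m (suc N) (length w)

module _ {A X : Set} where

  ⇒-trans : {t s r : Term A X} → t ⇒ s → s ⇒ r → t ⇒ r
  ⇒-trans done h = h
  ⇒-trans (step st h) h' = step st (⇒-trans h h')

  ⇒-=[]⇒ : {t s r : Term A X} {w : List A} → t ⇒ s → s =[ w ]⇒ r → t =[ w ]⇒ r
  ⇒-=[]⇒ h (wnil h') = wnil (⇒-trans h h')
  ⇒-=[]⇒ h (wcons h' st r) = wcons (⇒-trans h h') st r

  =[]⇒-++ : {t s r : Term A X} {w v : List A} → t =[ w ]⇒ s → s =[ v ]⇒ r → t =[ w ++ v ]⇒ r
  =[]⇒-++ (wnil h) q = ⇒-=[]⇒ h q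
  =[]⇒-++ (wcons h st r) q = wcons h st (=[]⇒-++ r q)

  tracesV⇒traces : {t : Term A X} {w : List A} {x : X} → TracesV t w x → Traces t w
  tracesV⇒traces (t' , p , _) = t' , p

  𝟎-traces : {q : Term A X} {v : List A} → 𝟎 =[ v ]⇒ q → v ≡ []
  𝟎-traces (wnil _) = refl
  𝟎-traces (wcons done () _)
  𝟎-traces (wcons (step () _) _ _)

  depth : Term A X → ℕ
  depth 𝟎 = 0
  depth (α · t) = suc (depth t)
  depth (t ⊕ u) = depth t ⊔ depth u
  depth (var _) = 0

  step-depth : {t t' : Term A X} {α : Act A} → t —⟨ α ⟩→ t' → depth t' < depth t
  step-depth pre = ≤-refl
  step-depth (sumˡ {t = t} {u = u} st) = ≤-trans (step-depth st) (m≤m⊔n (depth t) (depth u))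
  step-depth (sumʳ {t = t} {u = u} st) = ≤-trans (step-depth st) (m≤n⊔m (depth u) (depth t))

  ⇒-depth : {t t' : Term A X} → t ⇒ t' → depth t' ≤ depth t
  ⇒-depth done = ≤-refl
  ⇒-depth (step st h) = ≤-trans (⇒-depth h) (≤-trans (n≤1+n _) (step-depth st))

  traces-length≤depth : {t : Term A X} {w : List A} → Traces t w → length w ≤ depth t
  traces-length≤depth (_ , wnil _) = z≤n
  traces-length≤depth (_ , wcons h st r) =
    ≤-trans (s≤s (traces-length≤depth (_ , r))) (≤-trans (step-depth st) (⇒-depth h))

  actions : List A → Term A X
  actions [] = 𝟎
  actions (a ∷ w) = vis a · actions w

  actions-traces : (w : List A) → Traces (actions w) w
  actions-traces [] = 𝟎 , wnil done
  actions-traces (a ∷ w) = proj₁ (actions-traces w) , wcons done pre (proj₂ (actions-traces w))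

  actions-traces⁻ : (w : List A) {v : List A} → Traces (actions w) v → ∃ λ k → v ≡ take k w
  actions-traces⁻ w (_ , wnil _) = 0 , refl
  actions-traces⁻ (a ∷ w) (_ , wcons done pre r) with actions-traces⁻ w (_ , r)
  ... | k , refl = suc k , refl
  actions-traces⁻ (a ∷ w) (_ , wcons (step () _) _ _)

module _ {A : Set} (σ : V → Term A ⊥) where

  subst-step : {t t' : Term A V} {α : Act A} → t —⟨ α ⟩→ t' → subst σ t —⟨ α ⟩→ subst σ t'
  subst-step pre = pre
  subst-step (sumˡ st) = sumˡ (subst-step st)
  subst-step (sumʳ st) = sumʳ (subst-step st)

  subst-⇒ : {t t' : Term A V} → t ⇒ t' → subst σ t ⇒ subst σ t'
  subst-⇒ done = done
  subst-⇒ (step st h) = step (subst-step st) (subst-⇒ h)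

  subst-=[]⇒ : {t t' : Term A V} {w : List A} → t =[ w ]⇒ t' → subst σ t =[ w ]⇒ subst σ t'
  subst-=[]⇒ (wnil h) = wnil (subst-⇒ h)
  subst-=[]⇒ (wcons h st r) = wcons (subst-⇒ h) (subst-step st) (subst-=[]⇒ r)

  canVar-step : {t : Term A V} {y : V} {α : Act A} {p : Term A ⊥}
              → CanVar t y → σ y —⟨ α ⟩→ p → subst σ t —⟨ α ⟩→ p
  canVar-step here st = st
  canVar-step (varˡ c) st = sumˡ (canVar-step c st)
  canVar-step (varʳ c) st = sumʳ (canVar-step c st)

  canVar-traces : {t : Term A V} {y : V} {v : List A} → CanVar t y → Traces (σ y) v → Traces (subst σ t) v
  canVar-traces c (_ , wnil done) = _ , wnil done
  canVar-traces c (_ , wnil (step st h)) = _ , wnil (step (canVar-step c st) h)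
  canVar-traces c (_ , wcons done st r) = _ , wcons done (canVar-step c st) r
  canVar-traces c (_ , wcons (step st h) st' r) = _ , wcons (step (canVar-step c st) h) st' r

  traces-subst : {t : Term A V} {w : List A} → Traces t w → Traces (subst σ t) w
  traces-subst (_ , p) = _ , subst-=[]⇒ p

  tracesV-subst : {t : Term A V} {w v : List A} {y : V}
                → TracesV t w y → Traces (σ y) v → Traces (subst σ t) (w ++ v)
  tracesV-subst (_ , p , c) tr with canVar-traces c tr
  ... | q , r = q , =[]⇒-++ (subst-=[]⇒ p) r

  step-subst⁻ : (t : Term A V) {α : Act A} {p : Term A ⊥} → subst σ t —⟨ α ⟩→ p
              → (∃ λ t' → (t —⟨ α ⟩→ t') × (p ≡ subst σ t'))
                ⊎ (∃ λ y → CanVar t y × (σ y —⟨ α ⟩→ p))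
  step-subst⁻ 𝟎 ()
  step-subst⁻ (α · t) pre = inj₁ (t , pre , refl)
  step-subst⁻ (t ⊕ u) (sumˡ st) with step-subst⁻ t st
  ... | inj₁ (t' , st' , e) = inj₁ (t' , sumˡ st' , e)
  ... | inj₂ (y , c , sty) = inj₂ (y , varˡ c , sty)
  step-subst⁻ (t ⊕ u) (sumʳ st) with step-subst⁻ u st
  ... | inj₁ (t' , st' , e) = inj₁ (t' , sumʳ st' , e)
  ... | inj₂ (y , c , sty) = inj₂ (y , varʳ c , sty)
  step-subst⁻ (var y) st = inj₂ (y , here , st)

  ⇒-subst⁻ : (t : Term A V) {p : Term A ⊥} → subst σ t ⇒ p
           → (∃ λ t' → (t ⇒ t') × (p ≡ subst σ t'))
             ⊎ (∃₂ λ t' y → (t ⇒ t') × CanVar t' y × (σ y ⇒ p))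
  ⇒-subst⁻ t done = inj₁ (t , done , refl)
  ⇒-subst⁻ t (step st h) with step-subst⁻ t st
  ... | inj₂ (y , c , sty) = inj₂ (t , y , done , c , step sty h)
  ... | inj₁ (t₁ , st' , refl) with ⇒-subst⁻ t₁ h
  ...   | inj₁ (t' , h' , e) = inj₁ (t' , step st' h' , e)
  ...   | inj₂ (t' , y , h' , c , hy) = inj₂ (t' , y , step st' h' , c , hy)

  data SubstTrace (t : Term A V) (w : List A) : Set where
    ownTrace : Traces t w → SubstTrace t w
    varTrace : ∀ {w₁ w₂ y} → w ≡ w₁ ++ w₂ → TracesV t w₁ y → Traces (σ y) w₂ → SubstTrace t w

  SubstTrace-cons : {t t₁ t₂ : Term A V} {a : A} {w : List A}
                  → t ⇒ t₁ → t₁ —⟨ vis a ⟩→ t₂ → SubstTrace t₂ w → SubstTrace t (a ∷ w)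
  SubstTrace-cons h st (ownTrace (_ , p)) = ownTrace (_ , wcons h st p)
  SubstTrace-cons {a = a} h st (varTrace e (_ , p , c) tr) =
    varTrace (cong (a ∷_) e) (_ , wcons h st p , c) tr

  traces-subst⁻ : (t : Term A V) {w : List A} {p : Term A ⊥} → subst σ t =[ w ]⇒ p → SubstTrace t w
  traces-subst⁻ t (wnil h) with ⇒-subst⁻ t h
  ... | inj₁ (t' , h' , _) = ownTrace (t' , wnil h')
  ... | inj₂ (t' , y , h' , c , hy) = varTrace refl (t' , wnil h' , c) (_ , wnil hy)
  traces-subst⁻ t (wcons h st r) with ⇒-subst⁻ t h
  ... | inj₂ (t' , y , h' , c , hy) = varTrace refl (t' , wnil h' , c) (_ , wcons hy st r)
  ... | inj₁ (t₁ , h' , refl) with step-subst⁻ t₁ st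
  ...   | inj₂ (y , c , sty) = varTrace refl (t₁ , wnil h' , c) (_ , wcons done sty r)
  ...   | inj₁ (t₂ , st' , refl) = SubstTrace-cons h' st' (traces-subst⁻ t₂ r)

module _ {A : Set} where

  σ₀ : V → Term A ⊥
  σ₀ _ = 𝟎

  traces-subst-σ₀⁻ : (t : Term A V) {w : List A} → Traces (subst σ₀ t) w → Traces t w
  traces-subst-σ₀⁻ t (_ , p) with traces-subst⁻ σ₀ t p
  ... | ownTrace tr = tr
  ... | varTrace {w₁} e tv (_ , q) rewrite 𝟎-traces q | ++-identityʳ w₁ | e = tracesV⇒traces tv

  traces-⊆-via-σ₀ : (t u : Term A V) → (∀ w → Traces (subst σ₀ t) w → Traces (subst σ₀ u) w)
                  → ∀ w → Traces t w → Traces u w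
  traces-⊆-via-σ₀ t u incl w tr = traces-subst-σ₀⁻ u (incl w (traces-subst σ₀ tr))

  actions-∷-traces⁻ : {P : A → Set} {b : A} {y v : List A} → All P y → Traces {X = ⊥} (actions (b ∷ y)) v
                    → v ≡ [] ⊎ ∃ λ y' → v ≡ b ∷ y' × All P y'
  actions-∷-traces⁻ {y = y} py tr with actions-traces⁻ (_ ∷ y) tr
  ... | zero , refl = inj₁ refl
  ... | suc k , refl = inj₂ (take k y , refl , take⁺ k py)

  point : V → Term A ⊥ → V → Term A ⊥
  point x p y with y ≟ x
  ... | yes _ = p
  ... | no _ = 𝟎

  point-traces : (x : V) {p : Term A ⊥} {v : List A} → Traces p v → Traces (point x p x) v
  point-traces x tr with x ≟ x
  ... | yes _ = tr
  ... | no x≢x = ⊥-elim (x≢x refl)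

  point-traces⁻ : (x y : V) {p : Term A ⊥} {v : List A} → Traces (point x p y) v
                → (y ≡ x × Traces p v) ⊎ v ≡ []
  point-traces⁻ x y tr with y ≟ x
  ... | yes y≡x = inj₁ (y≡x , tr)
  ... | no _ = inj₂ (𝟎-traces (proj₂ tr))

  marker : A → A → ℕ → V → V → Term A ⊥
  marker a b N x = point x (actions (b ∷ replicate N a))

  tracesV-⊆-via-marker : {a b : A} → a ≢ b → (t u : Term A V) (x : V)
                       → (∀ v → Traces (subst (marker a b (depth u) x) t) v
                              → Traces (subst (marker a b (depth u) x) u) v)
                       → ∀ w → TracesV t w x → TracesV u w x
  tracesV-⊆-via-marker {a} {b} a≢b t u x incl w tv =
    via-subst-trace (traces-subst⁻ σ u (proj₂ (incl marked marked-trace)))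
    where
      N = depth u
      σ = marker a b N x
      marked = w ++ b ∷ replicate N a

      marked-trace : Traces (subst σ t) marked
      marked-trace = tracesV-subst σ tv (point-traces x (actions-traces _))

      too-long : ¬ Traces u marked
      too-long tr = <⇒≱ (n<length-++-∷-replicate w b a N) (traces-length≤depth tr)

      not-all-inside : ∀ {w₁ y} → marked ≡ w₁ ++ [] → ¬ TracesV u w₁ y
      not-all-inside {w₁} e tv′ =
        too-long (≡-subst (Traces u) (sym (trans e (++-identityʳ w₁))) (tracesV⇒traces tv′))

      via-subst-trace : SubstTrace σ u marked → TracesV u w x
      via-subst-trace (ownTrace tr) = ⊥-elim (too-long tr)
      via-subst-trace (varTrace {w₁ = w₁} {y = y} e tv′ tr₂) with point-traces⁻ x y tr₂
      ... | inj₂ refl = ⊥-elim (not-all-inside e tv′)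
      ... | inj₁ (refl , tr) with actions-∷-traces⁻ (replicate⁺ N a≢b) tr
      ...   | inj₁ refl = ⊥-elim (not-all-inside e tv′)
      ...   | inj₂ (_ , refl , ny) =
        ≡-subst (λ z → TracesV u z x) (sym (++-∷-cancelʳ w w₁ e (replicate⁺ N a≢b) ny)) tv′

lemma10 : {A : Set} → (∃₂ λ (a b : A) → a ≢ b) → (t u : Term A V) → t ⊑WIF u
        → (∀ (w : List A) → (Traces t w → Traces u w) × (Traces u w → Traces t w))
          × (∀ (w : List A) (x : V) → (TracesV t w x → TracesV u w x) × (TracesV u w x → TracesV t w x))
lemma10 (a , b , a≢b) t u t⊑u =
  (λ w → traces-⊆-via-σ₀ t u (traces-⊆ σ₀) w , traces-⊆-via-σ₀ u t (traces-⊇ σ₀) w)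
  , λ w x → tracesV-⊆-via-marker a≢b t u x (traces-⊆ (marker a b (depth u) x)) w
          , tracesV-⊆-via-marker a≢b u t x (traces-⊇ (marker a b (depth t) x)) w
  where
    traces-⊆ : ∀ σ w → Traces (subst σ t) w → Traces (subst σ u) w
    traces-⊆ σ w = proj₁ (proj₁ (proj₂ (t⊑u σ)) w)

    traces-⊇ : ∀ σ w → Traces (subst σ u) w → Traces (subst σ t) w
    traces-⊇ σ w = proj₂ (proj₁ (proj₂ (t⊑u σ)) w)
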